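{- Let $X,Y$ be objects of $\mathcal S$, let $F:\blacktriangleright(Y^X)\to Y^X$ be a morphism of $\mathcal S$, and let $\underline F:Y(\omega)^{X(\omega)}\to Y(\omega)^{X(\omega)}$ be a function of sets. Suppose that $\lim\circ\Gamma(F)=\underline F\circ\lim$ as maps $\Gamma(\blacktriangleright(Y^X))=\Gamma(Y^X)\to Y(\omega)^{X(\omega)}$. Then $F$ has a unique fixed point $u:1\to Y^X$ (i.e. $F\circ\mathsf{next}\circ u=u$), and $\lim(\Gamma(u)(*))=\lim(\Gamma(\mathsf{next}\circ u)(*))=u_\omega(*)_\omega$ is a fixed point of $\underline F$.
   Context: The topos of trees $\mathcal S$ presented as sheaves on $\omega$ with the Alexandrov topology, whose opens are $0\subseteq1\subseteq2\subseteq\cdots\subseteq\omega$: an object $X$ consists of sets $X(0)$ (a singleton), $X(1),X(2),\dots$ and $X(\omega)$, with restriction maps, where $X(\omega)$ is (up to isomorphism) the limit of $\cdots\to X(2)\to X(1)$; morphisms are natural families of functions $f_\nu:X(\nu)\to Y(\nu)$, $\nu\le\omega$. The global sections functor is $\Gamma(X)=X(\omega)$, and $\Gamma(f)=f_\omega$. The functor $\blacktriangleright$ is given by $(\blacktriangleright X)(n+1)=X(n)$, $(\blacktriangleright X)(0)=X(0)$, $(\blacktriangleright X)(\omega)=X(\omega)$; the natural transformation $\mathsf{next}:X\to\blacktriangleright X$ has $\mathsf{next}_{n+1}$ the restriction $X(n+1)\to X(n)$ and $\mathsf{next}_\omega=\mathrm{id}$, so $\Gamma(\blacktriangleright X)=\Gamma(X)$.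 For the exponential $Y^X$, an element of $\Gamma(Y^X)$ is a family $\{g_\nu\}_{\nu\le\omega}$ (a morphism $X\to Y$), and $\lim:\Gamma(Y^X)\to Y(\omega)^{X(\omega)}$ is $\lim(\{g_\nu\}_{\nu})=g_\omega$. A global element $u:1\to Y^X$ gives $\Gamma(u)(*)\in\Gamma(Y^X)$, written $u_\omega(*)$. -}

module Defs where

-- The topos of trees S, presented as sheaves on ω (Alexandrov topology
-- 0 ⊆ 1 ⊆ ... ⊆ ω), with setoids in place of sets (no quotients /
-- funext in --safe Agda).

open import Level using (0ℓ)
open import Data.Nat using (ℕ; zero; suc; _≤_; _≤′_; ≤′-refl; ≤′-step; _≤?_)
open import Data.Nat.Properties using (≤-refl; ≤-trans; n≤1+n; m≤n⇒m≤1+n; ≤⇒≤′; ≤′⇒≤)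
open import Data.Unit using (⊤; tt)
open import Data.Product using (_×_; _,_; proj₁; proj₂)
open import Data.Empty.Irrelevant using (⊥-elim)
open import Relation.Nullary using (¬_; yes; no)
open import Relation.Binary.Bundles using (Setoid)
open import Relation.Binary.PropositionalEquality as P using (_≡_)
open import Function.Bundles using (Func)
import Function.Relation.Binary.Setoid.Equality as FunEq

open Func public

private
  idF : ∀ {A : Setoid 0ℓ 0ℓ} → Func A A
  idF = record { to = λ x → x ; cong = λ e → e }

-- Objects: X(0) a singleton, X(1), X(2), ..., restrictions, and X(ω)
-- with projections forming a limit cone of ... → X(2) → X(1) → X(0).

record Obj : Set₁ where
  field
    S  : ℕ → Setoid 0ℓ 0ℓ
    r  : ∀ {n} → Func (S (suc n)) (S n)
    pt : Setoid.Carrier (S 0)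
    pt-unique : ∀ x → Setoid._≈_ (S 0) x pt
    Sω : Setoid 0ℓ 0ℓ
    π  : ∀ n → Func Sω (S n)
    π-r : ∀ n x → Setoid._≈_ (S n) (to r (to (π (suc n)) x)) (to (π n) x)
    glue : (x : ∀ n → Setoid.Carrier (S n))
         → (∀ n → Setoid._≈_ (S n) (to r (x (suc n))) (x n))
         → Setoid.Carrier Sω
    glue-π : ∀ x p n → Setoid._≈_ (S n) (to (π n) (glue x p)) (x n)
    π-jointly-injective : ∀ a b → (∀ n → Setoid._≈_ (S n) (to (π n) a) (to (π n) b))
                        → Setoid._≈_ Sω a b

open Obj public

infix 4 _∋_⊢_≈_ _∋ω_≈_
_∋_⊢_≈_ : (X : Obj) (n : ℕ) → Setoid.Carrier (S X n) → Setoid.Carrier (S X n) → Set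
X ∋ n ⊢ a ≈ b = Setoid._≈_ (S X n) a b

_∋ω_≈_ : (X : Obj) → Setoid.Carrier (Sω X) → Setoid.Carrier (Sω X) → Set
X ∋ω a ≈ b = Setoid._≈_ (Sω X) a b

record Hom (X Y : Obj) : Set where
  field
    f    : ∀ n → Func (S X n) (S Y n)
    nat  : ∀ n x → Y ∋ n ⊢ to (r Y) (to (f (suc n)) x) ≈ to (f n) (to (r X) x)
    fω   : Func (Sω X) (Sω Y)
    natω : ∀ n x → Y ∋ n ⊢ to (π Y n) (to fω x) ≈ to (f n) (to (π X n) x)

open Hom public

infix 4 _≈H_
_≈H_ : ∀ {X Y} → Hom X Y → Hom X Y → Set
_≈H_ {X} {Y} g h = (∀ n x → Y ∋ n ⊢ to (f g n) x ≈ to (f h n) x)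
                 × (∀ x → Y ∋ω to (fω g) x ≈ to (fω h) x)

HomSetoid : Obj → Obj → Setoid 0ℓ 0ℓ
HomSetoid X Y = record
  { Carrier = Hom X Y
  ; _≈_ = _≈H_
  ; isEquivalence = record
    { refl = (λ n x → Setoid.refl (S Y n)) , (λ x → Setoid.refl (Sω Y))
    ; sym = λ e → (λ n x → Setoid.sym (S Y n) (proj₁ e n x)) , (λ x → Setoid.sym (Sω Y) (proj₂ e x))
    ; trans = λ e d → (λ n x → Setoid.trans (S Y n) (proj₁ e n x) (proj₁ d n x))
                    , (λ x → Setoid.trans (Sω Y) (proj₂ e x) (proj₂ d x))
    }
  }

infixr 9 _∘H_
_∘H_ : ∀ {X Y Z} → Hom Y Z → Hom X Y → Hom X Z
_∘H_ {X} {Y} {Z} g h = record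
  { f = λ n → record { to = λ x → to (f g n) (to (f h n) x)
                     ; cong = λ e → cong (f g n) (cong (f h n) e) }
  ; nat = λ n x → Setoid.trans (S Z n) (nat g n (to (f h (suc n)) x)) (cong (f g n) (nat h n x))
  ; fω = record { to = λ x → to (fω g) (to (fω h) x)
                ; cong = λ e → cong (fω g) (cong (fω h) e) }
  ; natω = λ n x → Setoid.trans (S Z n) (natω g n (to (fω h) x)) (cong (f g n) (natω h n x))
  }

Γ : Obj → Setoid 0ℓ 0ℓ
Γ X = Sω X

Γ₁ : ∀ {X Y} → Hom X Y → Func (Γ X) (Γ Y)
Γ₁ = fω

⊤S : Setoid 0ℓ 0ℓ
⊤S = P.setoid ⊤

𝟏 : Obj
𝟏 = record
  { S = λ _ → ⊤S
  ; r = record { to = λ _ → tt ; cong = λ _ → P.refl }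
  ; pt = tt
  ; pt-unique = λ _ → P.refl
  ; Sω = ⊤S
  ; π = λ _ → record { to = λ _ → tt ; cong = λ _ → P.refl }
  ; π-r = λ _ _ → P.refl
  ; glue = λ _ _ → tt
  ; glue-π = λ _ _ _ → P.refl
  ; π-jointly-injective = λ _ _ _ → P.refl
  }

module _ (X : Obj) where
  private
    ▶S : ℕ → Setoid 0ℓ 0ℓ
    ▶S zero = S X zero
    ▶S (suc n) = S X n

    ▶r : ∀ n → Func (▶S (suc n)) (▶S n)
    ▶r zero = idF
    ▶r (suc n) = r X

    ▶π : ∀ n → Func (Sω X) (▶S n)
    ▶π zero = π X zero
    ▶π (suc n) = π X n

    ▶π-r : ∀ n x → Setoid._≈_ (▶S n) (to (▶r n) (to (▶π (suc n)) x)) (to (▶π n) x)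
    ▶π-r zero x = Setoid.refl (S X 0)
    ▶π-r (suc n) x = π-r X n x

    ▶glue : (x : ∀ n → Setoid.Carrier (▶S n))
          → (∀ n → Setoid._≈_ (▶S n) (to (▶r n) (x (suc n))) (x n))
          → Setoid.Carrier (Sω X)
    ▶glue x p = glue X (λ n → x (suc n)) (λ n → p (suc n))

    ▶glue-π : ∀ x p n → Setoid._≈_ (▶S n) (to (▶π n) (▶glue x p)) (x n)
    ▶glue-π x p zero = Setoid.trans (S X 0) (pt-unique X _) (Setoid.sym (S X 0) (pt-unique X _))
    ▶glue-π x p (suc n) = glue-π X _ _ n

  ▶ : Obj
  ▶ = record
    { S = ▶S
    ; r = λ {n} → ▶r n
    ; pt = pt X
    ; pt-unique = pt-unique X
    ; Sω = Sω X
    ; π = ▶π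
    ; π-r = ▶π-r
    ; glue = ▶glue
    ; glue-π = ▶glue-π
    ; π-jointly-injective = λ a b h → π-jointly-injective X a b (λ n → h (suc n))
    }

  private
    nextf : ∀ n → Func (S X n) (S ▶ n)
    nextf zero = idF
    nextf (suc n) = r X

    nextnat : ∀ n x → ▶ ∋ n ⊢ to (r ▶) (to (nextf (suc n)) x) ≈ to (nextf n) (to (r X) x)
    nextnat zero x = Setoid.refl (S X 0)
    nextnat (suc n) x = Setoid.refl (S X n)

    nextnatω : ∀ n x → ▶ ∋ n ⊢ to (π ▶ n) x ≈ to (nextf n) (to (π X n) x)
    nextnatω zero x = Setoid.refl (S X 0)
    nextnatω (suc n) x = Setoid.sym (S X n) (π-r X n x)

  next : Hom X ▶
  next = record { f = nextf ; nat = nextnat ; fω = idF ; natω = nextnatω }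

-- The exponential Y^X.
-- (Y^X)(n) = natural families g_k : X(k) → Y(k) for k ≤ n;
-- (Y^X)(ω) = morphisms X → Y.

record ExpEl (X Y : Obj) (n : ℕ) : Set where
  field
    g : (k : ℕ) → .(k ≤ n) → Func (S X k) (S Y k)
    g-nat : ∀ k .(p : suc k ≤ n) x
          → Y ∋ k ⊢ to (r Y) (to (g (suc k) p) x) ≈ to (g k (≤-trans (n≤1+n k) p)) (to (r X) x)

open ExpEl public

module _ (X Y : Obj) where
  private
    _≈E_ : ∀ {n} → ExpEl X Y n → ExpEl X Y n → Set
    _≈E_ {n} a b = ∀ k .(p : k ≤ n) x → Y ∋ k ⊢ to (g a k p) x ≈ to (g b k p) x

    ES : ℕ → Setoid 0ℓ 0ℓ
    ES n = record
      { Carrier = ExpEl X Y n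
      ; _≈_ = _≈E_
      ; isEquivalence = record
        { refl = λ k p x → Setoid.refl (S Y k)
        ; sym = λ e k p x → Setoid.sym (S Y k) (e k p x)
        ; trans = λ e d k p x → Setoid.trans (S Y k) (e k p x) (d k p x)
        }
      }

    ¬s≤z : ∀ {k} → ¬ (suc k ≤ 0)
    ¬s≤z ()

    Er : ∀ {n} → Func (ES (suc n)) (ES n)
    Er = record
      { to = λ a → record { g = λ k p → g a k (m≤n⇒m≤1+n p)
                          ; g-nat = λ k p x → g-nat a k (m≤n⇒m≤1+n p) x }
      ; cong = λ e k p x → e k (m≤n⇒m≤1+n p) x }

    Ept-g : (k : ℕ) → .(k ≤ 0) → Func (S X k) (S Y k)
    Ept-g zero p = record { to = λ _ → pt Y ; cong = λ _ → Setoid.refl (S Y 0) }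
    Ept-g (suc k) p = ⊥-elim (¬s≤z p)

    Ept : ExpEl X Y 0
    Ept = record { g = Ept-g ; g-nat = λ k p x → ⊥-elim (¬s≤z p) }

    Ept-unique : ∀ a → a ≈E Ept
    Ept-unique a zero p x = pt-unique Y _
    Ept-unique a (suc k) p x = ⊥-elim (¬s≤z p)

    Eπ : ∀ n → Func (HomSetoid X Y) (ES n)
    Eπ n = record
      { to = λ h → record { g = λ k _ → f h k ; g-nat = λ k _ x → nat h k x }
      ; cong = λ e k p x → proj₁ e k x }

    module Glue (G : ∀ n → ExpEl X Y n) (c : ∀ n → to Er (G (suc n)) ≈E G n) where
      gf : ∀ k → Func (S X k) (S Y k)
      gf k = g (G k) k ≤-refl

      gnat : ∀ k x → Y ∋ k ⊢ to (r Y) (to (gf (suc k)) x) ≈ to (gf k) (to (r X) x)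
      gnat k x = Setoid.trans (S Y k) (g-nat (G (suc k)) k ≤-refl x) (c k k ≤-refl (to (r X) x))

      fam : Setoid.Carrier (Sω X) → ∀ n → Setoid.Carrier (S Y n)
      fam x n = to (gf n) (to (π X n) x)

      famc : ∀ x n → Y ∋ n ⊢ to (r Y) (fam x (suc n)) ≈ fam x n
      famc x n = Setoid.trans (S Y n) (gnat n (to (π X (suc n)) x))
                   (cong (gf n) (π-r X n x))

      gω : Func (Sω X) (Sω Y)
      gω = record
        { to = λ x → glue Y (fam x) (famc x)
        ; cong = λ {x} {y} e → π-jointly-injective Y _ _ λ n →
            Setoid.trans (S Y n) (glue-π Y _ _ n)
              (Setoid.trans (S Y n) (cong (gf n) (cong (π X n) e))
                (Setoid.sym (S Y n) (glue-π Y _ _ n)))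
        }

      hom : Hom X Y
      hom = record { f = gf ; nat = gnat ; fω = gω ; natω = λ n x → glue-π Y _ _ n }

      L : ∀ {k n} → k ≤′ n → .(q : k ≤ n) → ∀ x → Y ∋ k ⊢ to (g (G k) k ≤-refl) x ≈ to (g (G n) k q) x
      L ≤′-refl q x = Setoid.refl (S Y _)
      L {k} (≤′-step {m} s) q x =
        Setoid.trans (S Y k) (L s (≤′⇒≤ s) x) (Setoid.sym (S Y k) (c m k (≤′⇒≤ s) x))

      glueπ : ∀ n → to (Eπ n) hom ≈E G n
      glueπ n k p x with k ≤? n
      ... | yes q = L (≤⇒≤′ q) p x
      ... | no ¬q = ⊥-elim (¬q p)

  Exp : Obj
  Exp = record
    { S = ES
    ; r = Er
    ; pt = Ept
    ; pt-unique = Ept-unique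
    ; Sω = HomSetoid X Y
    ; π = Eπ
    ; π-r = λ n h k p x → Setoid.refl (S Y k)
    ; glue = λ G c → Glue.hom G c
    ; glue-π = λ G c n → Glue.glueπ G c n
    ; π-jointly-injective = λ a b h →
        (λ n x → h n n ≤-refl x)
      , (λ x → π-jointly-injective Y _ _ λ n →
           Setoid.trans (S Y n) (natω a n x)
             (Setoid.trans (S Y n) (h n n ≤-refl (to (π X n) x))
               (Setoid.sym (S Y n) (natω b n x))))
    }

-- Y ^ X is the exponential object Y^X (Y first, as in the paper).
infixl 10 _^_
_^_ : Obj → Obj → Obj
Y ^ X = Exp X Y

FunSetoid : Setoid 0ℓ 0ℓ → Setoid 0ℓ 0ℓ → Setoid 0ℓ 0ℓ
FunSetoid A B = FunEq.setoid A B

lim : ∀ {X Y} → Setoid.Carrier (Γ (Y ^ X)) → Func (Sω X) (Sω Y)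
lim h = fω h

module Submission where

-- Lemma 4.3 is an instance of the Banach fixed-point theorem for the topos of
-- trees: every morphism F : ▶A → A (a "contractive" map) has a unique global
-- fixed point, for an arbitrary object A.
--
-- A global element 1 → A is the same thing as a compatible family of points
-- eₙ ∈ A(n), its ω-component being forced by the limit property of A(ω);
-- this is captured by `point` and `global-ext` below.  The fixed point of F
-- is glued from the approximants e₀ = the point of A(0), eₙ₊₁ = Fₙ₊₁(eₙ):
-- they are compatible because F is natural, F∘next fixes them stage by
-- stage, and any other fixed point agrees with them by induction on n.
--
-- The theorem takes A = Y^X.  Since Γ(next) is the identity, the ω-component
-- of the fixed-point equation says Γ(F)(h) ≈ h for h = Γ(u)(*); transporting
-- it along the hypothesis lim ∘ Γ(F) = F̲ ∘ lim shows that lim h is a fixed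
-- point of F̲.

open import Defs
open import Data.Nat using (ℕ; zero; suc)
open import Data.Unit using (tt)
open import Data.Product using (Σ; _×_; _,_; proj₁; proj₂)
open import Relation.Binary.Bundles using (Setoid)
open import Function.Bundles using (Func)
import Relation.Binary.Reasoning.Setoid as SetoidReasoning

module GlobalElements (A : Obj) where

  at : Hom 𝟏 A → (n : ℕ) → Setoid.Carrier (S A n)
  at u n = to (f u n) tt

  point : (e : ∀ n → Setoid.Carrier (S A n))
        → (∀ n → A ∋ n ⊢ to (r A) (e (suc n)) ≈ e n)
        → Hom 𝟏 A
  point e coh = record
    { f    = λ n → record { to = λ _ → e n ; cong = λ _ → Setoid.refl (S A n) }
    ; nat  = λ n _ → coh n
    ; fω   = record { to = λ _ → glue A e coh ; cong = λ _ → Setoid.refl (Sω A) }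
    ; natω = λ n _ → glue-π A e coh n
    }

  -- Global elements are determined by their finite-stage components: the
  -- ω-components agree because the projections A(ω) → A(n) are jointly
  -- injective and commute with u and v.
  global-ext : (u v : Hom 𝟏 A) → (∀ n → A ∋ n ⊢ at u n ≈ at v n) → u ≈H v
  global-ext u v agree = (λ n _ → agree n) , (λ _ → π-jointly-injective A _ _ stagewise)
    where
    stagewise : ∀ n → A ∋ n ⊢ to (π A n) (to (fω u) tt) ≈ to (π A n) (to (fω v) tt)
    stagewise n = begin
      to (π A n) (to (fω u) tt)  ≈⟨ natω u n tt ⟩
      at u n                     ≈⟨ agree n ⟩
      at v n                     ≈⟨ natω v n tt ⟨
      to (π A n) (to (fω v) tt)  ∎
      where open SetoidReasoning (S A n)

module Contractive (A : Obj) (F : Hom (▶ A) A) where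
  open GlobalElements A

  F₊ : ∀ n → Func (S A n) (S A (suc n))
  F₊ n = f F (suc n)

  approx : ∀ n → Setoid.Carrier (S A n)
  approx zero    = pt A
  approx (suc n) = to (F₊ n) (approx n)

  -- Restriction commutes with F (naturality), so the approximants are
  -- compatible; at stage 0 there is nothing to check, A(0) being a singleton.
  approx-coherent : ∀ n → A ∋ n ⊢ to (r A) (approx (suc n)) ≈ approx n
  approx-coherent zero    = pt-unique A _
  approx-coherent (suc n) = begin
    to (r A) (to (F₊ (suc n)) (approx (suc n)))  ≈⟨ nat F (suc n) (approx (suc n)) ⟩
    to (F₊ n) (to (r A) (approx (suc n)))        ≈⟨ cong (F₊ n) (approx-coherent n) ⟩
    to (F₊ n) (approx n)                         ∎
    where open SetoidReasoning (S A (suc n))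

  fixpoint : Hom 𝟏 A
  fixpoint = point approx approx-coherent

  is-fixed : (F ∘H next A ∘H fixpoint) ≈H fixpoint
  is-fixed = global-ext (F ∘H next A ∘H fixpoint) fixpoint stagewise
    where
    stagewise : ∀ n → A ∋ n ⊢ at (F ∘H next A ∘H fixpoint) n ≈ approx n
    stagewise zero    = pt-unique A _
    stagewise (suc n) = cong (F₊ n) (approx-coherent n)

  unique : (v : Hom 𝟏 A) → (F ∘H next A ∘H v) ≈H v → v ≈H fixpoint
  unique v v-fixed = global-ext v fixpoint stagewise
    where
    stagewise : ∀ n → A ∋ n ⊢ at v n ≈ approx n
    stagewise zero    = pt-unique A _
    stagewise (suc n) = begin
      at v (suc n)                         ≈⟨ proj₁ v-fixed (suc n) tt ⟨
      to (F₊ n) (to (r A) (at v (suc n)))  ≈⟨ cong (F₊ n) (nat v n tt) ⟩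
      to (F₊ n) (at v n)                   ≈⟨ cong (F₊ n) (stagewise n) ⟩
      to (F₊ n) (approx n)                 ∎
      where open SetoidReasoning (S A (suc n))

lemma4p3 : (X Y : Obj) (F : Hom (▶ (Y ^ X)) (Y ^ X))
    (Fbar : Func (FunSetoid (Sω X) (Sω Y)) (FunSetoid (Sω X) (Sω Y)))
    → (∀ (h : Setoid.Carrier (Γ (▶ (Y ^ X))))
    → Setoid._≈_ (FunSetoid (Sω X) (Sω Y)) (lim {X} {Y} (to (Γ₁ F) h)) (to Fbar (lim {X} {Y} h)))
    → Σ (Hom 𝟏 (Y ^ X)) (λ u →
    ((F ∘H next (Y ^ X) ∘H u) ≈H u)
    × (∀ (v : Hom 𝟏 (Y ^ X)) → (F ∘H next (Y ^ X) ∘H v) ≈H v → v ≈H u)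
    × Setoid._≈_ (FunSetoid (Sω X) (Sω Y)) (lim {X} {Y} (to (Γ₁ u) tt)) (lim {X} {Y} (to (Γ₁ (next (Y ^ X) ∘H u)) tt))
    × Setoid._≈_ (FunSetoid (Sω X) (Sω Y)) (to Fbar (lim {X} {Y} (to (Γ₁ u) tt))) (lim {X} {Y} (to (Γ₁ u) tt)))
lemma4p3 X Y F Fbar commutes =
  fixpoint , is-fixed , unique , (λ _ → Setoid.refl (Sω Y)) , lim-fixed
  where
  open Contractive (Y ^ X) F

  -- h = Γ(u)(*); Γ(next) is the identity, so lim(Γ(next ∘ u)(*)) is lim h
  -- on the nose (the third component above).
  h : Hom X Y
  h = to (Γ₁ fixpoint) tt

  -- F̲(lim h) = lim(Γ(F) h) by hypothesis, and Γ(F) h = h is the ω-component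
  -- of the fixed-point equation.
  lim-fixed : Setoid._≈_ (FunSetoid (Sω X) (Sω Y)) (to Fbar (lim {X} {Y} h)) (lim {X} {Y} h)
  lim-fixed x = begin
    to (to Fbar (lim h)) x        ≈⟨ commutes h x ⟨
    to (lim (to (Γ₁ F) h)) x      ≈⟨ proj₂ (proj₂ is-fixed tt) x ⟩
    to (lim h) x                  ∎
    where open SetoidReasoning (Sω Y)
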